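{- Let $\mathbf U=\langle\langle U,\approx\rangle,\preceq\rangle$ be a completely lattice $\mathbf L$-ordered set and $\sim$ a complete $\mathbf L$-tolerance on $\mathbf U$. The maximal blocks of $\sim$ are exactly the $\mathbf L$-intervals $[\![v,u]\!]$ where $\langle u,v\rangle$ ranges over the fixpoints of $\langle{}_\sim,{}^\sim\rangle$, i.e. the pairs $u,v\in U$ with $u_\sim=v$ and $v^\sim=u$.
   Context: $\mathbf L=\langle L,\wedge,\vee,\otimes,\to,0,1\rangle$ is a complete residuated lattice ($\langle L,\wedge,\vee,0,1\rangle$ complete lattice, $\langle L,\otimes,1\rangle$ commutative monoid, $a\otimes b\le c$ iff $a\le b\to c$). An $\mathbf L$-set in $X$ is a map $X\to L$; $L^X$ the set of them; $A\subseteq B$ iff $A(x)\le B(x)$ for all $x$; $S(A,B)=\bigwedge_x(A(x)\to B(x))$. An $\mathbf L$-equality is a binary $\mathbf L$-relation that is reflexive, symmetric, transitive ($R(x,y)\otimes R(y,z)\le R(x,z)$) and with $R(x,y)=1\Rightarrow x=y$. An $\mathbf L$-ordered set is $\langle\langle U,\approx\rangle,\preceq\rangle$, $\approx$ an $\mathbf L$-equality, $\preceq$ reflexive, transitive, compatible with $\approx$ ($(u\preceq v)\otimes(u\approx u')\otimes(v\approx v')\le(u'\preceq v')$), and $(u\preceq v)\wedge(v\preceq u)\le u\approx v$; $u\le v$ means $(u\preceq v)=1$. For $V\in L^U$: $\mathcal L V(v)=\bigwedge_u(V(u)\to(v\preceq u))$, $\mathcal U V(v)=\bigwedge_u(V(u)\to(u\preceq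 v))$; $\inf V$ is the unique $u$ with $\mathcal L V(u)=1=\mathcal U(\mathcal L V)(u)$, $\sup V$ the unique $u$ with $\mathcal U V(u)=1=\mathcal L(\mathcal U V)(u)$; completely lattice means these exist for all $V$. For $v\le u$, $[\![v,u]\!](w)=(v\preceq w)\wedge(w\preceq u)$. Power relation: for $R$ on $X$, $A,B\in L^X$, $(R\circ B)(x)=\bigvee_y R(x,y)\otimes B(y)$, $(A\circ R)(y)=\bigvee_x A(x)\otimes R(x,y)$, $R^+(A,B)=S(A,R\circ B)\wedge S(B,A\circ R)$. A binary $\mathbf L$-relation $R$ on $\mathbf U$ is complete if it is compatible with $\approx$ ($R(u,v)\otimes(u\approx u')\otimes(v\approx v')\le R(u',v')$) and $R^+(V_1,V_2)\le R(\inf V_1,\inf V_2)$, $R^+(V_1,V_2)\le R(\sup V_1,\sup V_2)$ for all $V_1,V_2\in L^U$. An $\mathbf L$-tolerance is a reflexive symmetric binary $\mathbf L$-relation. A block of $\sim$ is $B\in L^U$ with $B(x_1)\otimes B(x_2)\le x_1\sim x_2$ for all $x_1,x_2$; it is maximal if every block $B'$ with $B\subseteq B'$ equals $B$. For $u\in U$, $[u]_\sim(v)=u\sim v$, $u_\sim=\inf[u]_\sim$, $u^\sim=\sup[u]_\sim$. -}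

module Defs where

open import Level using (Level; suc; _⊔_)
open import Data.Product using (Σ; _×_; _,_)
open import Relation.Binary.PropositionalEquality using (_≡_)

record CompleteResLattice (a : Level) : Set (suc a) where
  infixr 6 _∧_
  infixr 5 _∨_
  infixr 7 _⊗_
  infixr 4 _⇒_
  infix 3 _≤_
  field
    L      : Set a
    _≤_    : L → L → Set a
    ≤-refl    : ∀ {x} → x ≤ x
    ≤-trans   : ∀ {x y z} → x ≤ y → y ≤ z → x ≤ z
    ≤-antisym : ∀ {x y} → x ≤ y → y ≤ x → x ≡ y
    ⋀ : {I : Set a} → (I → L) → L
    ⋀-lower    : ∀ {I : Set a} (f : I → L) (i : I) → ⋀ f ≤ f i
    ⋀-greatest : ∀ {I : Set a} (f : I → L) (x : L) → (∀ i → x ≤ f i) → x ≤ ⋀ f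
    ⋁ : {I : Set a} → (I → L) → L
    ⋁-upper : ∀ {I : Set a} (f : I → L) (i : I) → f i ≤ ⋁ f
    ⋁-least : ∀ {I : Set a} (f : I → L) (x : L) → (∀ i → f i ≤ x) → ⋁ f ≤ x
    _∧_ : L → L → L
    ∧-lowerˡ : ∀ x y → x ∧ y ≤ x
    ∧-lowerʳ : ∀ x y → x ∧ y ≤ y
    ∧-greatest : ∀ {x y z} → z ≤ x → z ≤ y → z ≤ x ∧ y
    _∨_ : L → L → L
    ∨-upperˡ : ∀ x y → x ≤ x ∨ y
    ∨-upperʳ : ∀ x y → y ≤ x ∨ y
    ∨-least : ∀ {x y z} → x ≤ z → y ≤ z → x ∨ y ≤ z
    𝟘 : L
    𝟘-least : ∀ x → 𝟘 ≤ x
    𝟙 : L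
    𝟙-greatest : ∀ x → x ≤ 𝟙
    _⊗_ : L → L → L
    ⊗-assoc : ∀ x y z → (x ⊗ y) ⊗ z ≡ x ⊗ (y ⊗ z)
    ⊗-comm  : ∀ x y → x ⊗ y ≡ y ⊗ x
    ⊗-identityʳ : ∀ x → x ⊗ 𝟙 ≡ x
    _⇒_ : L → L → L
    residuation⇒ : ∀ {x y z} → x ⊗ y ≤ z → x ≤ y ⇒ z
    residuation⇐ : ∀ {x y z} → x ≤ y ⇒ z → x ⊗ y ≤ z

module _ {a : Level} (𝐋 : CompleteResLattice a) where
  open CompleteResLattice 𝐋

  LSet : Set a → Set a
  LSet X = X → L

  _⊆_ : {X : Set a} → LSet X → LSet X → Set a
  A ⊆ B = ∀ x → A x ≤ B x

  S : {X : Set a} → LSet X → LSet X → L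
  S A B = ⋀ (λ x → A x ⇒ B x)

  _∘ʳ_ : {X : Set a} → (X → X → L) → LSet X → LSet X
  (R ∘ʳ B) x = ⋁ (λ y → R x y ⊗ B y)

  _ʳ∘_ : {X : Set a} → LSet X → (X → X → L) → LSet X
  (A ʳ∘ R) y = ⋁ (λ x → A x ⊗ R x y)

  _⁺ : {X : Set a} → (X → X → L) → LSet X → LSet X → L
  (R ⁺) A B = S A (R ∘ʳ B) ∧ S B (A ʳ∘ R)

  record IsLEquality {X : Set a} (E : X → X → L) : Set a where
    field
      refl  : ∀ x → E x x ≡ 𝟙
      sym   : ∀ x y → E x y ≡ E y x
      trans : ∀ x y z → E x y ⊗ E y z ≤ E x z
      sep   : ∀ x y → E x y ≡ 𝟙 → x ≡ y

  record LOrderedSet : Set (suc a) where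
    field
      U    : Set a
      _≈_  : U → U → L
      _⪯_  : U → U → L
      ≈-isLEquality : IsLEquality _≈_
      ⪯-refl   : ∀ u → (u ⪯ u) ≡ 𝟙
      ⪯-trans  : ∀ u v w → (u ⪯ v) ⊗ (v ⪯ w) ≤ (u ⪯ w)
      ⪯-compat : ∀ u v u' v' → (u ⪯ v) ⊗ (u ≈ u') ⊗ (v ≈ v') ≤ (u' ⪯ v')
      ⪯-antisym : ∀ u v → (u ⪯ v) ∧ (v ⪯ u) ≤ (u ≈ v)

  module _ (𝐔 : LOrderedSet) where
    open LOrderedSet 𝐔

    ℒ : LSet U → LSet U
    ℒ V v = ⋀ (λ u → V u ⇒ (v ⪯ u))

    𝒰 : LSet U → LSet U
    𝒰 V v = ⋀ (λ u → V u ⇒ (u ⪯ v))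

    IsInf : LSet U → U → Set a
    IsInf V u = (ℒ V u ≡ 𝟙) × (𝒰 (ℒ V) u ≡ 𝟙)

    IsSup : LSet U → U → Set a
    IsSup V u = (𝒰 V u ≡ 𝟙) × (ℒ (𝒰 V) u ≡ 𝟙)

    -- completely lattice: every L-set has an infimum and a supremum
    -- (these are unique, so a choice function is no extra assumption)
    record CompletelyLattice : Set a where
      field
        inf : LSet U → U
        inf-isInf : ∀ V → IsInf V (inf V)
        sup : LSet U → U
        sup-isSup : ∀ V → IsSup V (sup V)

    ⟦_,_⟧ : U → U → LSet U
    ⟦ v , u ⟧ w = (v ⪯ w) ∧ (w ⪯ u)

    IsTolerance : (U → U → L) → Set a
    IsTolerance R = (∀ x → R x x ≡ 𝟙) × (∀ x y → R x y ≡ R y x)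

    IsBlock : (U → U → L) → LSet U → Set a
    IsBlock R B = ∀ x₁ x₂ → B x₁ ⊗ B x₂ ≤ R x₁ x₂

    IsMaximalBlock : (U → U → L) → LSet U → Set a
    IsMaximalBlock R B =
      IsBlock R B × (∀ (B' : LSet U) → IsBlock R B' → B ⊆ B' → ∀ x → B' x ≡ B x)

    [_]_ : U → (U → U → L) → LSet U
    ([ u ] R) v = R u v

    module _ (CL : CompletelyLattice) where
      open CompletelyLattice CL

      IsComplete : (U → U → L) → Set a
      IsComplete R =
        (∀ u v u' v' → R u v ⊗ (u ≈ u') ⊗ (v ≈ v') ≤ R u' v')
        × (∀ V₁ V₂ → (R ⁺) V₁ V₂ ≤ R (inf V₁) (inf V₂))
        × (∀ V₁ V₂ → (R ⁺) V₁ V₂ ≤ R (sup V₁) (sup V₂))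

      lowerOf : (U → U → L) → U → U
      lowerOf R u = inf ([ u ] R)

      upperOf : (U → U → L) → U → U
      upperOf R u = sup ([ u ] R)

-- Completeness of ∼ lets us move ∼-degrees from two L-sets to their infima
-- and suprema.  Comparing suitable singletons and two-point L-sets this gives:
-- (i) the elements of a block B are ∼-related to inf B and sup B, so if B is
-- maximal both lie in B and B = ⟦inf B , sup B⟧; (ii) ⟦v , u⟧ is a block as soon as v ∼ u = 1.
-- Since u_∼ ∼ u = 1, the interval ⟦u_∼ , u⟧ (and dually ⟦v , v^∼⟧) is then a
-- block widening a maximal ⟦v , u⟧, so v = u_∼ and u = v^∼.  Conversely, for a
-- fixpoint v = u_∼, u = v^∼ every block containing ⟦v , u⟧ contains u and v, so
-- its elements are ∼-related to both and lie between u_∼ and v^∼.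
module Submission where

open import Defs
open import Level using (Level)
open import Data.Product using (Σ; _×_; _,_; proj₁; proj₂)
open import Function.Bundles using (_⇔_; mk⇔)
open import Relation.Binary.PropositionalEquality
  using (_≡_; refl; subst; cong; cong₂) renaming (sym to ≡-sym; trans to ≡-trans)

module ResiduatedLatticeProperties {ℓ : Level} (𝐋 : CompleteResLattice ℓ) where
  open CompleteResLattice 𝐋

  infixr 2 _▸_
  _▸_ : ∀ {x y z} → x ≤ y → y ≤ z → x ≤ z
  _▸_ = ≤-trans

  ≡⇒≤ : ∀ {x y} → x ≡ y → x ≤ y
  ≡⇒≤ refl = ≤-refl

  𝟙≤⇒≡𝟙 : ∀ {x} → 𝟙 ≤ x → x ≡ 𝟙
  𝟙≤⇒≡𝟙 {x} = ≤-antisym (𝟙-greatest x)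

  ≡𝟙⇒𝟙≤ : ∀ {x} → x ≡ 𝟙 → 𝟙 ≤ x
  ≡𝟙⇒𝟙≤ refl = ≤-refl

  ⊗-identityˡ : ∀ x → 𝟙 ⊗ x ≡ x
  ⊗-identityˡ x = ≡-trans (⊗-comm 𝟙 x) (⊗-identityʳ x)

  ⊗-monoˡ : ∀ {x y z} → x ≤ y → x ⊗ z ≤ y ⊗ z
  ⊗-monoˡ x≤y = residuation⇐ (x≤y ▸ residuation⇒ ≤-refl)

  ⊗-monoʳ : ∀ {x y z} → x ≤ y → z ⊗ x ≤ z ⊗ y
  ⊗-monoʳ {x} {y} {z} x≤y = ≡⇒≤ (⊗-comm z x) ▸ ⊗-monoˡ x≤y ▸ ≡⇒≤ (⊗-comm y z)

  ⊗-mono : ∀ {x y z w} → x ≤ y → z ≤ w → x ⊗ z ≤ y ⊗ w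
  ⊗-mono x≤y z≤w = ⊗-monoˡ x≤y ▸ ⊗-monoʳ z≤w

  x⊗y≤x : ∀ x y → x ⊗ y ≤ x
  x⊗y≤x x y = ⊗-monoʳ (𝟙-greatest y) ▸ ≡⇒≤ (⊗-identityʳ x)

  x⊗y≤y : ∀ x y → x ⊗ y ≤ y
  x⊗y≤y x y = ⊗-monoˡ (𝟙-greatest x) ▸ ≡⇒≤ (⊗-identityˡ y)

  x≤𝟙⊗x : ∀ {x} → x ≤ 𝟙 ⊗ x
  x≤𝟙⊗x {x} = ≡⇒≤ (≡-sym (⊗-identityˡ x))

  x≤x⊗y : ∀ {x y} → 𝟙 ≤ y → x ≤ x ⊗ y
  x≤x⊗y {x} 𝟙≤y = ≡⇒≤ (≡-sym (⊗-identityʳ x)) ▸ ⊗-monoʳ 𝟙≤y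

  𝟙≤⊗ : ∀ {x y} → 𝟙 ≤ x → 𝟙 ≤ y → 𝟙 ≤ x ⊗ y
  𝟙≤⊗ 𝟙≤x 𝟙≤y = x≤x⊗y 𝟙≤y ▸ ⊗-monoˡ 𝟙≤x

  ⊗-∨-leastˡ : ∀ {x y z w} → x ⊗ z ≤ w → y ⊗ z ≤ w → (x ∨ y) ⊗ z ≤ w
  ⊗-∨-leastˡ x⊗z≤w y⊗z≤w = residuation⇐ (∨-least (residuation⇒ x⊗z≤w) (residuation⇒ y⊗z≤w))

  ⊗-∨-leastʳ : ∀ {x y z w} → z ⊗ x ≤ w → z ⊗ y ≤ w → z ⊗ (x ∨ y) ≤ w
  ⊗-∨-leastʳ {x} {y} {z} z⊗x≤w z⊗y≤w = ≡⇒≤ (⊗-comm z (x ∨ y))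
    ▸ ⊗-∨-leastˡ (≡⇒≤ (⊗-comm x z) ▸ z⊗x≤w) (≡⇒≤ (⊗-comm y z) ▸ z⊗y≤w)

  ⇒-elim : ∀ {x y} → 𝟙 ≤ (x ⇒ y) → x ≤ y
  ⇒-elim {x} 𝟙≤x⇒y = x≤𝟙⊗x ▸ residuation⇐ 𝟙≤x⇒y

  ⇒-intro : ∀ {x y} → x ≤ y → 𝟙 ≤ (x ⇒ y)
  ⇒-intro {x} x≤y = residuation⇒ (≡⇒≤ (⊗-identityˡ x) ▸ x≤y)

  ≤-⋁ : ∀ {I : Set ℓ} (f : I → L) i {x} → x ≤ f i → x ≤ ⋁ f
  ≤-⋁ f i x≤fi = x≤fi ▸ ⋁-upper f i

  module _ {X : Set ℓ} where

    -- {c/x}, as a join indexed by x ≡ w so that no decidable equality on X is needed.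
    singleton : X → L → LSet 𝐋 X
    singleton x c w = ⋁ {I = x ≡ w} (λ _ → c)

    singleton-∋ : ∀ {x c} → c ≤ singleton x c x
    singleton-∋ {x} {c} = ⋁-upper (λ (_ : x ≡ x) → c) refl

    singleton-least : ∀ (P : LSet 𝐋 X) {x c} → c ≤ P x → ∀ w → singleton x c w ≤ P w
    singleton-least P {x} {c} c≤Px w = ⋁-least (λ (_ : x ≡ w) → c) (P w) (λ { refl → c≤Px })

    singleton-⊗-least : ∀ (P : LSet 𝐋 X) {x c} d → c ⊗ d ≤ P x →
                        ∀ w → singleton x c w ⊗ d ≤ P w
    singleton-⊗-least P d c⊗d≤Px w =
      residuation⇐ (singleton-least (λ w → d ⇒ P w) (residuation⇒ c⊗d≤Px) w)

    pair : X → L → X → L → LSet 𝐋 X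
    pair p α q β w = singleton p α w ∨ singleton q β w

    pair-∋ˡ : ∀ {p α q β} → α ≤ pair p α q β p
    pair-∋ˡ = singleton-∋ ▸ ∨-upperˡ _ _

    pair-∋ʳ : ∀ {p α q β} → β ≤ pair p α q β q
    pair-∋ʳ = singleton-∋ ▸ ∨-upperʳ _ _

    pair-least : ∀ (P : LSet 𝐋 X) {p α q β} → α ≤ P p → β ≤ P q →
                 ∀ w → pair p α q β w ≤ P w
    pair-least P α≤Pp β≤Pq w = ∨-least (singleton-least P α≤Pp w) (singleton-least P β≤Pq w)

    pair-⊗-least : ∀ (P : LSet 𝐋 X) {p α q β} d → α ⊗ d ≤ P p → β ⊗ d ≤ P q →
                   ∀ w → pair p α q β w ⊗ d ≤ P w
    pair-⊗-least P d α⊗d≤Pp β⊗d≤Pq w = residuation⇐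
      (pair-least (λ w → d ⇒ P w) (residuation⇒ α⊗d≤Pp) (residuation⇒ β⊗d≤Pq) w)

module OrderedSetProperties {ℓ : Level} (𝐋 : CompleteResLattice ℓ) (𝐔 : LOrderedSet 𝐋) where
  open CompleteResLattice 𝐋
  open LOrderedSet 𝐔
  open ResiduatedLatticeProperties 𝐋

  𝟙≤⪯-refl : ∀ u → 𝟙 ≤ (u ⪯ u)
  𝟙≤⪯-refl u = ≡𝟙⇒𝟙≤ (⪯-refl u)

  𝟙≤⪯-antisym : ∀ {u v} → 𝟙 ≤ (u ⪯ v) → 𝟙 ≤ (v ⪯ u) → u ≡ v
  𝟙≤⪯-antisym {u} {v} u⪯v v⪯u =
    IsLEquality.sep ≈-isLEquality u v (𝟙≤⇒≡𝟙 (∧-greatest u⪯v v⪯u ▸ ⪯-antisym u v))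

  module _ {V : LSet 𝐋 U} {x : U} where

    isInf⇒lower : IsInf 𝐋 𝐔 V x → ∀ w → V w ≤ (x ⪯ w)
    isInf⇒lower (isLower , _) w =
      ⇒-elim (≡𝟙⇒𝟙≤ isLower ▸ ⋀-lower (λ u → V u ⇒ (x ⪯ u)) w)

    isInf⇒greatest : IsInf 𝐋 𝐔 V x → ∀ w → ℒ 𝐋 𝐔 V w ≤ (w ⪯ x)
    isInf⇒greatest (_ , isGreatest) w =
      ⇒-elim (≡𝟙⇒𝟙≤ isGreatest ▸ ⋀-lower (λ u → ℒ 𝐋 𝐔 V u ⇒ (u ⪯ x)) w)

    isSup⇒upper : IsSup 𝐋 𝐔 V x → ∀ w → V w ≤ (w ⪯ x)
    isSup⇒upper (isUpper , _) w =
      ⇒-elim (≡𝟙⇒𝟙≤ isUpper ▸ ⋀-lower (λ u → V u ⇒ (u ⪯ x)) w)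

    isSup⇒least : IsSup 𝐋 𝐔 V x → ∀ w → 𝒰 𝐋 𝐔 V w ≤ (x ⪯ w)
    isSup⇒least (_ , isLeast) w =
      ⇒-elim (≡𝟙⇒𝟙≤ isLeast ▸ ⋀-lower (λ u → 𝒰 𝐋 𝐔 V u ⇒ (x ⪯ u)) w)

    minimum⇒isInf : 𝟙 ≤ V x → (∀ w → V w ≤ (x ⪯ w)) → IsInf 𝐋 𝐔 V x
    minimum⇒isInf x∈V lower =
        𝟙≤⇒≡𝟙 (⋀-greatest _ 𝟙 (λ w → ⇒-intro (lower w)))
      , 𝟙≤⇒≡𝟙 (⋀-greatest _ 𝟙 (λ w → ⇒-intro
          (x≤x⊗y x∈V ▸ residuation⇐ (⋀-lower (λ u → V u ⇒ (w ⪯ u)) x))))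

    maximum⇒isSup : 𝟙 ≤ V x → (∀ w → V w ≤ (w ⪯ x)) → IsSup 𝐋 𝐔 V x
    maximum⇒isSup x∈V upper =
        𝟙≤⇒≡𝟙 (⋀-greatest _ 𝟙 (λ w → ⇒-intro (upper w)))
      , 𝟙≤⇒≡𝟙 (⋀-greatest _ 𝟙 (λ w → ⇒-intro
          (x≤x⊗y x∈V ▸ residuation⇐ (⋀-lower (λ u → V u ⇒ (u ⪯ w)) x))))

  isInf-unique : ∀ {V x y} → IsInf 𝐋 𝐔 V x → IsInf 𝐋 𝐔 V y → x ≡ y
  isInf-unique {x = x} {y} x-inf y-inf = 𝟙≤⪯-antisym
    (≡𝟙⇒𝟙≤ (proj₁ x-inf) ▸ isInf⇒greatest y-inf x)
    (≡𝟙⇒𝟙≤ (proj₁ y-inf) ▸ isInf⇒greatest x-inf y)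

  isSup-unique : ∀ {V x y} → IsSup 𝐋 𝐔 V x → IsSup 𝐋 𝐔 V y → x ≡ y
  isSup-unique {x = x} {y} x-sup y-sup = 𝟙≤⪯-antisym
    (≡𝟙⇒𝟙≤ (proj₁ y-sup) ▸ isSup⇒least x-sup y)
    (≡𝟙⇒𝟙≤ (proj₁ x-sup) ▸ isSup⇒least y-sup x)

  ⟦_,_⟧ᵤ : U → U → LSet 𝐋 U
  ⟦ v , u ⟧ᵤ = ⟦_,_⟧ 𝐋 𝐔 v u

  block-∋⇒≤ : ∀ {R B p} → IsBlock 𝐋 𝐔 R B → 𝟙 ≤ B p → ∀ x → B x ≤ R p x
  block-∋⇒≤ {p = p} isBlock p∈B x = x≤𝟙⊗x ▸ ⊗-monoˡ p∈B ▸ isBlock p x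

  interval-∋ˡ : ∀ {v u} → 𝟙 ≤ (v ⪯ u) → 𝟙 ≤ ⟦ v , u ⟧ᵤ v
  interval-∋ˡ {v} v⪯u = ∧-greatest (𝟙≤⪯-refl v) v⪯u

  interval-∋ʳ : ∀ {v u} → 𝟙 ≤ (v ⪯ u) → 𝟙 ≤ ⟦ v , u ⟧ᵤ u
  interval-∋ʳ {u = u} v⪯u = ∧-greatest v⪯u (𝟙≤⪯-refl u)

  interval-⊆ : ∀ {v u v' u'} → 𝟙 ≤ (v' ⪯ v) → 𝟙 ≤ (u ⪯ u') →
               _⊆_ 𝐋 ⟦ v , u ⟧ᵤ ⟦ v' , u' ⟧ᵤ
  interval-⊆ {v} {u} {v'} {u'} v'⪯v u⪯u' w = ∧-greatest
    (∧-lowerˡ _ _ ▸ x≤𝟙⊗x ▸ ⊗-monoˡ v'⪯v ▸ ⪯-trans v' v w)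
    (∧-lowerʳ _ _ ▸ x≤x⊗y u⪯u' ▸ ⪯-trans w u u')

  interval-lower-injective : ∀ {v v' u} → 𝟙 ≤ (v' ⪯ v) → 𝟙 ≤ (v' ⪯ u) →
    (∀ w → ⟦ v' , u ⟧ᵤ w ≡ ⟦ v , u ⟧ᵤ w) → v' ≡ v
  interval-lower-injective {v' = v'} v'⪯v v'⪯u same =
    𝟙≤⪯-antisym v'⪯v (interval-∋ˡ v'⪯u ▸ ≡⇒≤ (same v') ▸ ∧-lowerˡ _ _)

  interval-upper-injective : ∀ {v u u'} → 𝟙 ≤ (u ⪯ u') → 𝟙 ≤ (v ⪯ u') →
    (∀ w → ⟦ v , u' ⟧ᵤ w ≡ ⟦ v , u ⟧ᵤ w) → u' ≡ u
  interval-upper-injective {u' = u'} u⪯u' v⪯u' same =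
    𝟙≤⪯-antisym (interval-∋ʳ v⪯u' ▸ ≡⇒≤ (same u') ▸ ∧-lowerʳ _ _) u⪯u'

module CompleteToleranceProperties {ℓ : Level} (𝐋 : CompleteResLattice ℓ) (𝐔 : LOrderedSet 𝐋)
  (CL : CompletelyLattice 𝐋 𝐔) (∼ : LOrderedSet.U 𝐔 → LOrderedSet.U 𝐔 → CompleteResLattice.L 𝐋)
  (isTolerance : IsTolerance 𝐋 𝐔 ∼) (isComplete : IsComplete 𝐋 𝐔 CL ∼) where
  open CompleteResLattice 𝐋
  open LOrderedSet 𝐔
  open CompletelyLattice CL
  open ResiduatedLatticeProperties 𝐋
  open OrderedSetProperties 𝐋 𝐔

  ∼-refl : ∀ x → 𝟙 ≤ ∼ x x
  ∼-refl x = ≡𝟙⇒𝟙≤ (proj₁ isTolerance x)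

  ∼-sym : ∀ x y → ∼ x y ≤ ∼ y x
  ∼-sym x y = ≡⇒≤ (proj₂ isTolerance x y)

  ∼⁺ : LSet 𝐋 U → LSet 𝐋 U → L
  ∼⁺ = _⁺ 𝐋 ∼

  ∼⁺-≤-inf : ∀ V₁ V₂ → ∼⁺ V₁ V₂ ≤ ∼ (inf V₁) (inf V₂)
  ∼⁺-≤-inf = proj₁ (proj₂ isComplete)

  ∼⁺-≤-sup : ∀ V₁ V₂ → ∼⁺ V₁ V₂ ≤ ∼ (sup V₁) (sup V₂)
  ∼⁺-≤-sup = proj₂ (proj₂ isComplete)

  inf-minimum : ∀ {V x} → 𝟙 ≤ V x → (∀ w → V w ≤ (x ⪯ w)) → inf V ≡ x
  inf-minimum {V} x∈V lower = isInf-unique (inf-isInf V) (minimum⇒isInf x∈V lower)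

  sup-maximum : ∀ {V x} → 𝟙 ≤ V x → (∀ w → V w ≤ (w ⪯ x)) → sup V ≡ x
  sup-maximum {V} x∈V upper = isSup-unique (sup-isSup V) (maximum⇒isSup x∈V upper)

  inf-singleton : ∀ y → inf (singleton y 𝟙) ≡ y
  inf-singleton y = inf-minimum singleton-∋ (singleton-least (y ⪯_) (𝟙≤⪯-refl y))

  sup-singleton : ∀ y → sup (singleton y 𝟙) ≡ y
  sup-singleton y = sup-maximum singleton-∋ (singleton-least (_⪯ y) (𝟙≤⪯-refl y))

  ≤-∼⁺ : ∀ {V₁ V₂ c} → (∀ w → V₁ w ⊗ c ≤ _∘ʳ_ 𝐋 ∼ V₂ w) →
         (∀ w → V₂ w ⊗ c ≤ _ʳ∘_ 𝐋 V₁ ∼ w) → c ≤ ∼⁺ V₁ V₂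
  ≤-∼⁺ {V₁} {V₂} {c} forth back = ∧-greatest
    (⋀-greatest _ c (λ w → residuation⇒ (≡⇒≤ (⊗-comm c (V₁ w)) ▸ forth w)))
    (⋀-greatest _ c (λ w → residuation⇒ (≡⇒≤ (⊗-comm c (V₂ w)) ▸ back w)))

  ≤-∼⁺-pair : ∀ {p α q β r γ s δ c} →
    let V₁ = pair p α q β ; V₂ = pair r γ s δ in
    α ⊗ c ≤ _∘ʳ_ 𝐋 ∼ V₂ p → β ⊗ c ≤ _∘ʳ_ 𝐋 ∼ V₂ q →
    γ ⊗ c ≤ _ʳ∘_ 𝐋 V₁ ∼ r → δ ⊗ c ≤ _ʳ∘_ 𝐋 V₁ ∼ s → c ≤ ∼⁺ V₁ V₂
  ≤-∼⁺-pair {c = c} p↦ q↦ ↤r ↤s =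
    ≤-∼⁺ (pair-⊗-least _ c p↦ q↦) (pair-⊗-least _ c ↤r ↤s)

  ≤-∼⁺-singleton : ∀ {V y c} → c ≤ V y → (∀ w → V w ⊗ c ≤ ∼ w y) →
                   c ≤ ∼⁺ V (singleton y 𝟙)
  ≤-∼⁺-singleton {y = y} {c} y∈V V∼y = ≤-∼⁺
    (λ w → ≤-⋁ _ y (V∼y w ▸ x≤x⊗y singleton-∋))
    (singleton-⊗-least _ c (≤-⋁ _ y (x⊗y≤y 𝟙 c ▸ y∈V ▸ x≤x⊗y (∼-refl y))))

  ≤-∼-inf : ∀ {V y c} → c ≤ V y → (∀ w → V w ⊗ c ≤ ∼ w y) → c ≤ ∼ (inf V) y
  ≤-∼-inf {V} {y} y∈V V∼y = ≤-∼⁺-singleton y∈V V∼y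
    ▸ ∼⁺-≤-inf V (singleton y 𝟙) ▸ ≡⇒≤ (cong (∼ (inf V)) (inf-singleton y))

  ≤-∼-sup : ∀ {V y c} → c ≤ V y → (∀ w → V w ⊗ c ≤ ∼ w y) → c ≤ ∼ (sup V) y
  ≤-∼-sup {V} {y} y∈V V∼y = ≤-∼⁺-singleton y∈V V∼y
    ▸ ∼⁺-≤-sup V (singleton y 𝟙) ▸ ≡⇒≤ (cong (∼ (sup V)) (sup-singleton y))

  ∼-sym-⊗𝟙 : ∀ u w → ∼ u w ⊗ 𝟙 ≤ ∼ w u
  ∼-sym-⊗𝟙 u w = ≡⇒≤ (⊗-identityʳ _) ▸ ∼-sym u w

  lowerOf-∼ : ∀ u → 𝟙 ≤ ∼ (lowerOf 𝐋 𝐔 CL ∼ u) u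
  lowerOf-∼ u = ≤-∼-inf (∼-refl u) (∼-sym-⊗𝟙 u)

  upperOf-∼ : ∀ u → 𝟙 ≤ ∼ (upperOf 𝐋 𝐔 CL ∼ u) u
  upperOf-∼ u = ≤-∼-sup (∼-refl u) (∼-sym-⊗𝟙 u)

  block-≤-∼-inf : ∀ {B} → IsBlock 𝐋 𝐔 ∼ B → ∀ y → B y ≤ ∼ (inf B) y
  block-≤-∼-inf isBlock y = ≤-∼-inf ≤-refl (λ w → isBlock w y)

  block-≤-∼-sup : ∀ {B} → IsBlock 𝐋 𝐔 ∼ B → ∀ y → B y ≤ ∼ (sup B) y
  block-≤-∼-sup isBlock y = ≤-∼-sup ≤-refl (λ w → isBlock w y)

  -- Match x with x and v with u: ∼⁺ of {x, v} and {u, x} is then at least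
  -- ⟦ v , u ⟧ x, and these two L-sets have suprema x and u.
  interval-≤-∼ : ∀ {v u} → 𝟙 ≤ ∼ v u → ∀ x → ⟦ v , u ⟧ᵤ x ≤ ∼ x u
  interval-≤-∼ {v} {u} v∼u x =
    ≤-∼⁺-pair x↦x v↦u u↤v x↤x ▸ ∼⁺-≤-sup V₁ V₂ ▸ ≡⇒≤ (cong₂ ∼ sup-V₁ sup-V₂)
    where
    V₁ V₂ : LSet 𝐋 U
    V₁ = pair x 𝟙 v (v ⪯ x)
    V₂ = pair u 𝟙 x (x ⪯ u)
    c : L
    c = ⟦ v , u ⟧ᵤ x
    sup-V₁ : sup V₁ ≡ x
    sup-V₁ = sup-maximum pair-∋ˡ (pair-least (_⪯ x) (𝟙≤⪯-refl x) ≤-refl)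
    sup-V₂ : sup V₂ ≡ u
    sup-V₂ = sup-maximum pair-∋ˡ (pair-least (_⪯ u) (𝟙≤⪯-refl u) ≤-refl)
    x↦x : 𝟙 ⊗ c ≤ _∘ʳ_ 𝐋 ∼ V₂ x
    x↦x = ≤-⋁ _ x (x⊗y≤y 𝟙 c ▸ ∧-lowerʳ _ _ ▸ x≤𝟙⊗x ▸ ⊗-mono (∼-refl x) pair-∋ʳ)
    v↦u : (v ⪯ x) ⊗ c ≤ _∘ʳ_ 𝐋 ∼ V₂ v
    v↦u = ≤-⋁ _ u (𝟙-greatest _ ▸ 𝟙≤⊗ v∼u pair-∋ˡ)
    u↤v : 𝟙 ⊗ c ≤ _ʳ∘_ 𝐋 V₁ ∼ u
    u↤v = ≤-⋁ _ v (x⊗y≤y 𝟙 c ▸ ∧-lowerˡ _ _ ▸ x≤x⊗y v∼u ▸ ⊗-monoˡ pair-∋ʳ)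
    x↤x : (x ⪯ u) ⊗ c ≤ _ʳ∘_ 𝐋 V₁ ∼ x
    x↤x = ≤-⋁ _ x (𝟙-greatest _ ▸ 𝟙≤⊗ pair-∋ˡ (∼-refl x))

  -- Match x₁ with u and u with x₂ between {x₁, u} and {x₂, u}, whose infima
  -- are x₁ and x₂.
  interval-isBlock : ∀ {v u} → 𝟙 ≤ ∼ v u → IsBlock 𝐋 𝐔 ∼ ⟦ v , u ⟧ᵤ
  interval-isBlock {v} {u} v∼u x₁ x₂ =
    ≤-∼⁺-pair x₁↦u u↦x₂ x₂↤u u↤x₁ ▸ ∼⁺-≤-inf V₁ V₂ ▸ ≡⇒≤ (cong₂ ∼ inf-V₁ inf-V₂)
    where
    V₁ V₂ : LSet 𝐋 U
    V₁ = pair x₁ 𝟙 u (x₁ ⪯ u)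
    V₂ = pair x₂ 𝟙 u (x₂ ⪯ u)
    c : L
    c = ⟦ v , u ⟧ᵤ x₁ ⊗ ⟦ v , u ⟧ᵤ x₂
    inf-V₁ : inf V₁ ≡ x₁
    inf-V₁ = inf-minimum pair-∋ˡ (pair-least (x₁ ⪯_) (𝟙≤⪯-refl x₁) ≤-refl)
    inf-V₂ : inf V₂ ≡ x₂
    inf-V₂ = inf-minimum pair-∋ˡ (pair-least (x₂ ⪯_) (𝟙≤⪯-refl x₂) ≤-refl)
    x₁∼u : ⟦ v , u ⟧ᵤ x₁ ≤ ∼ x₁ u
    x₁∼u = interval-≤-∼ v∼u x₁
    u∼x₂ : ⟦ v , u ⟧ᵤ x₂ ≤ ∼ u x₂
    u∼x₂ = interval-≤-∼ v∼u x₂ ▸ ∼-sym x₂ u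
    x₁↦u : 𝟙 ⊗ c ≤ _∘ʳ_ 𝐋 ∼ V₂ x₁
    x₁↦u = ≤-⋁ _ u (x⊗y≤y 𝟙 c ▸ ⊗-mono x₁∼u (∧-lowerʳ _ _ ▸ pair-∋ʳ))
    u↦x₂ : (x₁ ⪯ u) ⊗ c ≤ _∘ʳ_ 𝐋 ∼ V₂ u
    u↦x₂ = ≤-⋁ _ x₂ (x⊗y≤y _ c ▸ x⊗y≤y _ _ ▸ u∼x₂ ▸ x≤x⊗y pair-∋ˡ)
    x₂↤u : 𝟙 ⊗ c ≤ _ʳ∘_ 𝐋 V₁ ∼ x₂
    x₂↤u = ≤-⋁ _ u (x⊗y≤y 𝟙 c ▸ ⊗-mono (∧-lowerʳ _ _ ▸ pair-∋ʳ) u∼x₂)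
    u↤x₁ : (x₂ ⪯ u) ⊗ c ≤ _ʳ∘_ 𝐋 V₁ ∼ u
    u↤x₁ = ≤-⋁ _ x₁ (x⊗y≤y _ c ▸ x⊗y≤x _ _ ▸ x₁∼u ▸ x≤𝟙⊗x ▸ ⊗-monoˡ pair-∋ˡ)

  block-∨-singleton : ∀ {B p} → IsBlock 𝐋 𝐔 ∼ B → (∀ y → B y ≤ ∼ p y) →
                      IsBlock 𝐋 𝐔 ∼ (λ w → B w ∨ singleton p 𝟙 w)
  block-∨-singleton {B} {p} isBlock B∼p x y = ⊗-∨-leastˡ
    (⊗-∨-leastʳ (isBlock x y)
      (≡⇒≤ (⊗-comm (B x) _) ▸ singleton-⊗-least (∼ x) (B x) (x⊗y≤y 𝟙 _ ▸ B∼p x ▸ ∼-sym p x) y))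
    (⊗-∨-leastʳ
      (singleton-⊗-least (λ x → ∼ x y) (B y) (x⊗y≤y 𝟙 _ ▸ B∼p y) x)
      (singleton-⊗-least (λ x → ∼ x y) _
        (x⊗y≤y 𝟙 _ ▸ singleton-least (∼ p) (∼-refl p) y) x))

  maximalBlock-∋ : ∀ {B p} → IsMaximalBlock 𝐋 𝐔 ∼ B → (∀ y → B y ≤ ∼ p y) → 𝟙 ≤ B p
  maximalBlock-∋ {B} {p} (isBlock , maximal) B∼p = singleton-∋ ▸ ∨-upperʳ _ _ ▸ ≡⇒≤
    (maximal _ (block-∨-singleton isBlock B∼p) (λ w → ∨-upperˡ (B w) _) p)

  maximalBlock-interval : ∀ {B} → IsMaximalBlock 𝐋 𝐔 ∼ B →
    𝟙 ≤ ∼ (inf B) (sup B) × (∀ w → ⟦ inf B , sup B ⟧ᵤ w ≡ B w)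
  maximalBlock-interval {B} isMaximal@(isBlock , maximal) =
    inf∼sup , maximal _ (interval-isBlock inf∼sup) B⊆interval
    where
    inf∼sup : 𝟙 ≤ ∼ (inf B) (sup B)
    inf∼sup = 𝟙≤⊗ (maximalBlock-∋ isMaximal (block-≤-∼-inf isBlock))
                  (maximalBlock-∋ isMaximal (block-≤-∼-sup isBlock))
            ▸ isBlock (inf B) (sup B)
    B⊆interval : _⊆_ 𝐋 B ⟦ inf B , sup B ⟧ᵤ
    B⊆interval x = ∧-greatest (isInf⇒lower (inf-isInf B) x) (isSup⇒upper (sup-isSup B) x)

  maximalBlock-interval-widen : ∀ {B v u v' u'} → IsMaximalBlock 𝐋 𝐔 ∼ B →
    (∀ w → ⟦ v , u ⟧ᵤ w ≡ B w) → 𝟙 ≤ ∼ v' u' → 𝟙 ≤ (v' ⪯ v) → 𝟙 ≤ (u ⪯ u') →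
    ∀ w → ⟦ v' , u' ⟧ᵤ w ≡ ⟦ v , u ⟧ᵤ w
  maximalBlock-interval-widen (_ , maximal) B≗ v'∼u' v'⪯v u⪯u' w = ≡-trans
    (maximal _ (interval-isBlock v'∼u') (λ x → ≡⇒≤ (≡-sym (B≗ x)) ▸ interval-⊆ v'⪯v u⪯u' x) w)
    (≡-sym (B≗ w))

  IsFixpointInterval : LSet 𝐋 U → Set ℓ
  IsFixpointInterval B = Σ U (λ u → Σ U (λ v →
    (lowerOf 𝐋 𝐔 CL ∼ u ≡ v) × (upperOf 𝐋 𝐔 CL ∼ v ≡ u) × (∀ w → B w ≡ ⟦ v , u ⟧ᵤ w)))

  maximalBlock⇒fixpointInterval : ∀ {B} → IsMaximalBlock 𝐋 𝐔 ∼ B → IsFixpointInterval B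
  maximalBlock⇒fixpointInterval {B} isMaximal =
    b , a , a'≡a , b'≡b , λ w → ≡-sym (B≗ w)
    where
    a b a' b' : U
    a = inf B
    b = sup B
    a' = lowerOf 𝐋 𝐔 CL ∼ b
    b' = upperOf 𝐋 𝐔 CL ∼ a
    a∼b : 𝟙 ≤ ∼ a b
    a∼b = proj₁ (maximalBlock-interval isMaximal)
    B≗ : ∀ w → ⟦ a , b ⟧ᵤ w ≡ B w
    B≗ = proj₂ (maximalBlock-interval isMaximal)
    a'-lower : ∀ w → ∼ b w ≤ (a' ⪯ w)
    a'-lower = isInf⇒lower (inf-isInf (∼ b))
    b'-upper : ∀ w → ∼ a w ≤ (w ⪯ b')
    b'-upper = isSup⇒upper (sup-isSup (∼ a))
    a'⪯a : 𝟙 ≤ (a' ⪯ a)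
    a'⪯a = a∼b ▸ ∼-sym a b ▸ a'-lower a
    b⪯b' : 𝟙 ≤ (b ⪯ b')
    b⪯b' = a∼b ▸ b'-upper b
    a'≡a : a' ≡ a
    a'≡a = interval-lower-injective a'⪯a (∼-refl b ▸ a'-lower b)
      (maximalBlock-interval-widen isMaximal B≗ (lowerOf-∼ b) a'⪯a (𝟙≤⪯-refl b))
    b'≡b : b' ≡ b
    b'≡b = interval-upper-injective b⪯b' (∼-refl a ▸ b'-upper a)
      (maximalBlock-interval-widen isMaximal B≗ (upperOf-∼ a ▸ ∼-sym b' a) (𝟙≤⪯-refl a) b⪯b')

  fixpointInterval⇒maximalBlock : ∀ {B} → IsFixpointInterval B → IsMaximalBlock 𝐋 𝐔 ∼ B
  fixpointInterval⇒maximalBlock {B} (u , v , u∼≡v , v∼≡u , B≗) = isBlock , maximal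
    where
    v-inf : IsInf 𝐋 𝐔 (∼ u) v
    v-inf = subst (IsInf 𝐋 𝐔 (∼ u)) u∼≡v (inf-isInf (∼ u))
    u-sup : IsSup 𝐋 𝐔 (∼ v) u
    u-sup = subst (IsSup 𝐋 𝐔 (∼ v)) v∼≡u (sup-isSup (∼ v))
    v∼u : 𝟙 ≤ ∼ v u
    v∼u = subst (λ z → 𝟙 ≤ ∼ z u) u∼≡v (lowerOf-∼ u)
    v⪯u : 𝟙 ≤ (v ⪯ u)
    v⪯u = ∼-refl u ▸ isInf⇒lower v-inf u
    isBlock : IsBlock 𝐋 𝐔 ∼ B
    isBlock x₁ x₂ = ≡⇒≤ (cong₂ _⊗_ (B≗ x₁) (B≗ x₂)) ▸ interval-isBlock v∼u x₁ x₂
    maximal : ∀ B' → IsBlock 𝐋 𝐔 ∼ B' → _⊆_ 𝐋 B B' → ∀ x → B' x ≡ B x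
    maximal B' isBlock' B⊆B' x = ≤-antisym (B'x≤ ▸ ≡⇒≤ (≡-sym (B≗ x))) (B⊆B' x)
      where
      ∈B' : ∀ {p} → 𝟙 ≤ ⟦ v , u ⟧ᵤ p → 𝟙 ≤ B' p
      ∈B' {p} p∈ = p∈ ▸ ≡⇒≤ (≡-sym (B≗ p)) ▸ B⊆B' p
      B'x≤ : B' x ≤ ⟦ v , u ⟧ᵤ x
      B'x≤ = ∧-greatest
        (block-∋⇒≤ isBlock' (∈B' (interval-∋ʳ v⪯u)) x ▸ isInf⇒lower v-inf x)
        (block-∋⇒≤ isBlock' (∈B' (interval-∋ˡ v⪯u)) x ▸ isSup⇒upper u-sup x)

theorem12 : ∀ {a : Level} (𝐋 : CompleteResLattice a) (𝐔 : LOrderedSet 𝐋)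
              (CL : CompletelyLattice 𝐋 𝐔)
              (∼ : LOrderedSet.U 𝐔 → LOrderedSet.U 𝐔 → CompleteResLattice.L 𝐋) →
              IsTolerance 𝐋 𝐔 ∼ → IsComplete 𝐋 𝐔 CL ∼ →
              ∀ (B : LOrderedSet.U 𝐔 → CompleteResLattice.L 𝐋) →
              IsMaximalBlock 𝐋 𝐔 ∼ B
                ⇔ Σ (LOrderedSet.U 𝐔) (λ u → Σ (LOrderedSet.U 𝐔) (λ v →
                    (lowerOf 𝐋 𝐔 CL ∼ u ≡ v) × (upperOf 𝐋 𝐔 CL ∼ v ≡ u)
                      × (∀ w → B w ≡ ⟦_,_⟧ 𝐋 𝐔 v u w)))
theorem12 𝐋 𝐔 CL ∼ isTolerance isComplete B =
  mk⇔ maximalBlock⇒fixpointInterval fixpointInterval⇒maximalBlock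
  where open CompleteToleranceProperties 𝐋 𝐔 CL ∼ isTolerance isComplete
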